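{- Let $Q$ be a connected loop-less quiver with $m\ge 2$ vertices, let $\xi=\xi^-_Q$ have orbits $\mathcal{O}_1,\dots,\mathcal{O}_\ell$ on the vertex set, of sizes $\pi_1\ge\dots\ge\pi_\ell$, choose a vertex $v^1_t\in\mathcal{O}_t$, set $v^{r+1}_t=\xi(v^r_t)$ for $1\le r<\pi_t$, and let $\beta_t$ be the concatenated walk $\alpha^-_Q(v^1_t)\alpha^-_Q(v^2_t)\cdots\alpha^-_Q(v^{\pi_t}_t)$. Then for every $t_0\in\{1,\dots,\ell\}$ the set $\{\mathrm{inc}(\beta_t)\mid 1\le t\le\ell,\ t\ne t_0\}$ is a $\mathbb{Z}$-basis of the reduced radical $\mathrm{rad}_{re}(q_Q)$.
   Context: A quiver $Q$ has vertices $\{1,\dots,m\}$, arrows $\{1,\dots,n\}$ (arrows totally ordered by their numbers), source/target maps $s,t$; loop-less: $s(i)\neq t(i)$; connected: underlying graph connected. $I(Q)$ is the $m\times n$ matrix with $i$-th column $\mathbf{e}_{s(i)}-\mathbf{e}_{t(i)}$, $q_Q(x)=\frac12\|I(Q)x\|^2$, $G_Q=I(Q)^{\mathrm{tr}}I(Q)$, $\check G_Q$ upper triangular with $\check G_Q+\check G_Q^{\mathrm{tr}}=G_Q$. $\mathrm{rad}(q_Q)=\ker G_Q$ and $\mathrm{rad}_{re}(q_Q)=\{x\in\mathrm{rad}(q_Q)\mid y^{\mathrm{tr}}\check G_Qx=0\ \forall y\in\mathrm{rad}(q_Q)\}$. Walks: a walk is $w=(v_0,i_1,v_1,\dots,i_\ell,v_\ell)$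 with $\{s(i_r),t(i_r)\}=\{v_{r-1},v_r\}$; source $v_0$, target $v_\ell$; written $i_1^{\epsilon_1}\cdots i_\ell^{\epsilon_\ell}$ with $\epsilon_r=+1$ if $(s(i_r),t(i_r))=(v_{r-1},v_r)$ and $-1$ otherwise; $\ell=0$ gives a trivial walk. Its incidence vector is $\mathrm{inc}(w)=\sum_r\epsilon_r\mathbf{e}_{i_r}\in\mathbb{Z}^n$. Walks with matching target/source are concatenated. A walk is minimally descending if for each $r<\ell$, $i_{r+1}$ is the largest arrow $j<i_r$ having $v_r$ as an endpoint. A (descending) structural walk is a minimally descending walk $w$ such that whenever a concatenation $w'ww''$ is minimally descending, $w'$ and $w''$ are trivial. For each vertex $v$ there is a unique structural walk $\alpha^-_Q(v)$ with source $v$; $\xi^-_Q(v)$ denotes its target, and $\xi^-_Q$ is a permutation of the vertex set. -}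

module Defs where

open import Data.Nat as ℕ using (ℕ; zero; suc)
open import Data.Integer as ℤ using (ℤ; +_; -_)
open import Data.Fin as Fin using (Fin; toℕ)
open import Data.Bool using (Bool; true; false; if_then_else_)
open import Data.List using (List; []; _∷_; _++_)
open import Data.Product using (Σ; _×_; _,_; ∃)
open import Data.Sum using (_⊎_)
open import Data.Unit using (⊤)
open import Relation.Binary.PropositionalEquality using (_≡_)
open import Relation.Nullary using (¬_; does)

record Quiver : Set where
  field
    m n : ℕ
    s t : Fin n → Fin m

∑ : {k : ℕ} → (Fin k → ℤ) → ℤ
∑ {zero} f = + 0
∑ {suc k} f = f Fin.zero ℤ.+ ∑ (λ i → f (Fin.suc i))

iter : {A : Set} → (A → A) → ℕ → A → A
iter f zero a = a
iter f (suc k) a = f (iter f k a)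

module _ (Q : Quiver) where
  open Quiver Q

  Loopless : Set
  Loopless = ∀ i → ¬ (s i ≡ t i)

  -- A step of a walk: an arrow together with an orientation
  -- (true = traversed along the arrow, ε = +1; false = against it, ε = -1).
  Step : Set
  Step = Fin n × Bool

  stepStart : Step → Fin m
  stepStart (i , true) = s i
  stepStart (i , false) = t i

  stepEnd : Step → Fin m
  stepEnd (i , true) = t i
  stepEnd (i , false) = s i

  -- A walk is given by its source vertex v₀ and its list of steps;
  -- it is valid if consecutive steps match up.
  ValidWalk : Fin m → List Step → Set
  ValidWalk v [] = ⊤
  ValidWalk v (x ∷ ws) = (stepStart x ≡ v) × ValidWalk (stepEnd x) ws

  walkTarget : Fin m → List Step → Fin m
  walkTarget v [] = v
  walkTarget v (x ∷ ws) = walkTarget (stepEnd x) ws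

  Connected : Set
  Connected = ∀ u v → Σ (List Step) λ ws → ValidWalk u ws × walkTarget u ws ≡ v

  Incident : Fin n → Fin m → Set
  Incident j v = (s j ≡ v) ⊎ (t j ≡ v)

  MinDescStep : Step → Step → Set
  MinDescStep (i , ε) (j , δ) =
    (j Fin.< i) × Incident j (stepEnd (i , ε)) ×
    (∀ k → k Fin.< i → Incident k (stepEnd (i , ε)) → k Fin.≤ j)

  MinDescSteps : List Step → Set
  MinDescSteps [] = ⊤
  MinDescSteps (x ∷ []) = ⊤
  MinDescSteps (x ∷ y ∷ ws) = MinDescStep x y × MinDescSteps (y ∷ ws)

  MinimallyDescending : Fin m → List Step → Set
  MinimallyDescending v ws = ValidWalk v ws × MinDescSteps ws

  Structural : Fin m → List Step → Set
  Structural v ws =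
    MinimallyDescending v ws ×
    (∀ (u : Fin m) (p q : List Step) → walkTarget u p ≡ v →
       MinimallyDescending u (p ++ (ws ++ q)) → (p ≡ []) × (q ≡ []))

  sign : Bool → ℤ
  sign true = + 1
  sign false = - (+ 1)

  inc : List Step → Fin n → ℤ
  inc [] a = + 0
  inc ((j , ε) ∷ ws) a = (if does (j Fin.≟ a) then sign ε else + 0) ℤ.+ inc ws a

  δ : Fin m → Fin m → ℤ
  δ u v = if does (u Fin.≟ v) then + 1 else + 0

  Inc : Fin m → Fin n → ℤ
  Inc v i = δ (s i) v ℤ.- δ (t i) v

  G : Fin n → Fin n → ℤ
  G i j = ∑ λ v → Inc v i ℤ.* Inc v j

  -- Upper triangular Ǧ_Q with Ǧ + Ǧᵀ = G. For a loop-less quiver G i i = 2,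
  -- so the diagonal entries of Ǧ are 1.
  Gˇ : Fin n → Fin n → ℤ
  Gˇ i j = if does (i Fin.<? j) then G i j
           else (if does (i Fin.≟ j) then + 1 else + 0)

  -- rad(q_Q) = ker G_Q  (integer vectors)
  InRad : (Fin n → ℤ) → Set
  InRad x = ∀ i → ∑ (λ j → G i j ℤ.* x j) ≡ + 0

  bilinˇ : (Fin n → ℤ) → (Fin n → ℤ) → ℤ
  bilinˇ y x = ∑ λ i → ∑ λ j → y i ℤ.* (Gˇ i j ℤ.* x j)

  InRadRe : (Fin n → ℤ) → Set
  InRadRe x = InRad x × (∀ y → InRad y → bilinˇ y x ≡ + 0)

  -- Given α (α v = steps of the structural walk with source v),
  -- ξ v = target of α v.
  ξ : (Fin m → List Step) → Fin m → Fin m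
  ξ α v = walkTarget v (α v)

  βSteps : (Fin m → List Step) → ℕ → Fin m → List Step
  βSteps α zero v = []
  βSteps α (suc k) v = α v ++ βSteps α k (ξ α v)

lincomb : {ℓ n : ℕ} → (Fin ℓ → ℤ) → (Fin ℓ → Fin n → ℤ) → Fin n → ℤ
lincomb c b a = ∑ λ t → c t ℤ.* b t a

module Submission where

-- Ǧ is unitriangular, and for a structural walk α(v) one has Ǧ inc(α v) = I(Q)ᵀ e_v: the arrows of a
-- minimally descending walk decrease, so the columns of G picked up by Ǧ telescope to the row of I(Q)
-- at v truncated at the first arrow, and maximality of the walk makes the truncation invisible.
-- Hence Ǧ inc(β_t) = I(Q)ᵀ 1_{O_t}, which puts β_t in rad_re; as Q is connected, Ǧ ∑ c_t β_t = 0
-- forces all c_t to be equal, so the β_t are independent once c_{t₀} = 0.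
-- Conversely, for x ∈ rad_re the vector Ǧx is orthogonal to rad(q_Q), hence equals I(Q)ᵀ u for a
-- potential u; pairing with inc(α w) gives u(ξ w) = u(w), so u is constant on the ξ-orbits and
-- x = ∑ u(v¹_t) β_t because Ǧ is injective.

open import Defs
open import Data.Nat using (ℕ; _≤_; _<_)
open import Data.Integer using (ℤ; +_)
open import Data.Fin using (Fin)
open import Data.List using (List)
open import Data.Product using (Σ; _×_)
open import Relation.Binary.PropositionalEquality using (_≡_)
open import Relation.Nullary using (¬_)

open import Data.Nat as ℕ using (zero; suc; z≤n; s≤s; NonZero)
open import Data.List using ([]; _∷_; _++_)
import Data.Nat.Properties as ℕP
open import Data.Nat.DivMod using (_%_; _/_; m≡m%n+[m/n]*n; m%n<n)
open import Data.Integer as ℤ using (-_; _+_; _*_; _-_)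
open import Data.Integer.Properties hiding (_≟_)
open import Data.Integer.Tactic.RingSolver using (solve-∀)
open import Data.Fin as Fin using (_≟_)
import Data.Fin.Properties as FinP
import Data.List.Properties as LP
open import Data.Fin.Induction using (>-wellFounded)
open import Induction.WellFounded using (module All)
open import Data.Bool using (true; false; if_then_else_)
open import Data.Product using (_,_; proj₁; proj₂; ∃-syntax)
open import Function using (_∘_; flip; case_of_)
open import Relation.Binary.PropositionalEquality
open import Relation.Binary.Definitions using (tri<; tri≈; tri>)
open import Relation.Nullary using (does; yes; no; Dec)
open import Relation.Nullary.Decidable using (dec-true; dec-false; _⊎-dec_; _×-dec_)
open import Data.Empty using (⊥-elim)
open import Data.Sum using (inj₁; inj₂; reduce)
open import Data.Unit using (tt)

∑-cong : ∀ {k} {f g : Fin k → ℤ} → (∀ i → f i ≡ g i) → ∑ f ≡ ∑ g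
∑-cong {zero} e = refl
∑-cong {suc k} e = cong₂ _+_ (e Fin.zero) (∑-cong (e ∘ Fin.suc))

∑-zero : ∀ {k} {f : Fin k → ℤ} → (∀ i → f i ≡ + 0) → ∑ f ≡ + 0
∑-zero {zero} e = refl
∑-zero {suc k} e = cong₂ _+_ (e Fin.zero) (∑-zero (e ∘ Fin.suc))

∑-distrib-+ : ∀ {k} (f g : Fin k → ℤ) → ∑ (λ i → f i + g i) ≡ ∑ f + ∑ g
∑-distrib-+ {zero} f g = refl
∑-distrib-+ {suc k} f g =
  trans (cong (_+_ (f Fin.zero + g Fin.zero)) (∑-distrib-+ (f ∘ Fin.suc) (g ∘ Fin.suc)))
        (+-interchange (f Fin.zero) (g Fin.zero) _ _)
  where
  +-interchange : ∀ a b c d → a + b + (c + d) ≡ a + c + (b + d)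
  +-interchange = solve-∀

∑-distrib-neg : ∀ {k} (f : Fin k → ℤ) → ∑ (λ i → - f i) ≡ - ∑ f
∑-distrib-neg {zero} f = refl
∑-distrib-neg {suc k} f =
  trans (cong (_+_ (- f Fin.zero)) (∑-distrib-neg (f ∘ Fin.suc))) (sym (neg-distrib-+ (f Fin.zero) _))

∑-distrib-- : ∀ {k} (f g : Fin k → ℤ) → ∑ (λ i → f i - g i) ≡ ∑ f - ∑ g
∑-distrib-- f g = trans (∑-distrib-+ f (-_ ∘ g)) (cong (_+_ (∑ f)) (∑-distrib-neg g))

*-distribˡ-∑ : ∀ {k} c (f : Fin k → ℤ) → c * ∑ f ≡ ∑ (λ i → c * f i)
*-distribˡ-∑ {zero} c f = *-zeroʳ c
*-distribˡ-∑ {suc k} c f =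
  trans (*-distribˡ-+ c (f Fin.zero) _) (cong (_+_ (c * f Fin.zero)) (*-distribˡ-∑ c (f ∘ Fin.suc)))

*-distribʳ-∑ : ∀ {k} c (f : Fin k → ℤ) → ∑ f * c ≡ ∑ (λ i → f i * c)
*-distribʳ-∑ c f = trans (*-comm (∑ f) c) (trans (*-distribˡ-∑ c f) (∑-cong (λ i → *-comm c (f i))))

∑-comm : ∀ {k l} (f : Fin k → Fin l → ℤ) → ∑ (λ i → ∑ (f i)) ≡ ∑ (λ j → ∑ (λ i → f i j))
∑-comm {zero} {l} f = sym (∑-zero {l} (λ _ → refl))
∑-comm {suc k} f =
  trans (cong (_+_ (∑ (f Fin.zero))) (∑-comm (f ∘ Fin.suc)))
        (sym (∑-distrib-+ (f Fin.zero) (λ j → ∑ (λ i → f (Fin.suc i) j))))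

∑-single : ∀ {k} (a : Fin k) (f : Fin k → ℤ) → (∀ j → ¬ (a ≡ j) → f j ≡ + 0) → ∑ f ≡ f a
∑-single Fin.zero f e =
  trans (cong (_+_ (f Fin.zero)) (∑-zero (λ j → e (Fin.suc j) (λ ())))) (+-identityʳ _)
∑-single (Fin.suc a) f e =
  trans (cong (_+ ∑ (f ∘ Fin.suc)) (e Fin.zero (λ ()))) (trans (+-identityˡ _)
        (∑-single a (f ∘ Fin.suc) (λ j a≢j → e (Fin.suc j) (a≢j ∘ FinP.suc-injective))))

-- Carrying the partial sum as a natural number keeps every partial sum visibly nonnegative.
∑-ℕ≡0 : ∀ {k} a (g : Fin k → ℕ) → + a + ∑ (λ i → + g i) ≡ + 0 → a ≡ 0 × (∀ i → g i ≡ 0)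
∑-ℕ≡0 {zero} a g e = ℕP.m+n≡0⇒m≡0 a (+-injective e) , λ ()
∑-ℕ≡0 {suc k} a g e
  with ∑-ℕ≡0 (a ℕ.+ g Fin.zero) (g ∘ Fin.suc) (trans (+-assoc (+ a) (+ g Fin.zero) (∑ (λ i → + g (Fin.suc i)))) e)
... | a+g₀≡0 , rest≡0 =
  ℕP.m+n≡0⇒m≡0 a a+g₀≡0 , λ { Fin.zero → ℕP.m+n≡0⇒n≡0 a a+g₀≡0 ; (Fin.suc i) → rest≡0 i }

i*i≡∣i∣*∣i∣ : ∀ i → i * i ≡ + (ℤ.∣ i ∣ ℕ.* ℤ.∣ i ∣)
i*i≡∣i∣*∣i∣ (+ zero) = refl
i*i≡∣i∣*∣i∣ (+ suc n) = refl
i*i≡∣i∣*∣i∣ ℤ.-[1+ n ] = refl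

∑-squares≡0 : ∀ {k} (f : Fin k → ℤ) → ∑ (λ i → f i * f i) ≡ + 0 → ∀ i → f i ≡ + 0
∑-squares≡0 f e i = reduce (i*j≡0⇒i≡0∨j≡0 (f i) (trans (i*i≡∣i∣*∣i∣ (f i)) (cong +_ (∣f∣²≡0 i))))
  where
  ∣f∣²≡0 : ∀ i → ℤ.∣ f i ∣ ℕ.* ℤ.∣ f i ∣ ≡ 0
  ∣f∣²≡0 = proj₂ (∑-ℕ≡0 0 (λ i → ℤ.∣ f i ∣ ℕ.* ℤ.∣ f i ∣)
                    (trans (+-identityˡ _) (trans (sym (∑-cong (i*i≡∣i∣*∣i∣ ∘ f))) e)))

*-distribˡ-minus : ∀ a b c → a * (b - c) ≡ a * b - a * c
*-distribˡ-minus = solve-∀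

apply : ∀ {k l} → (Fin k → Fin l → ℤ) → (Fin l → ℤ) → Fin k → ℤ
apply M x i = ∑ λ j → M i j * x j

dot : ∀ {k} → (Fin k → ℤ) → (Fin k → ℤ) → ℤ
dot x y = ∑ λ i → x i * y i

gram : ∀ {k l} → (Fin k → Fin l → ℤ) → Fin l → Fin l → ℤ
gram M i j = ∑ λ v → M v i * M v j

basis : ∀ {k} → Fin k → ℤ → Fin k → ℤ
basis j c a = if does (j ≟ a) then c else + 0

∑-basis : ∀ {k} (f : Fin k → ℤ) j c → ∑ (λ i → f i * basis j c i) ≡ f j * c
∑-basis f j c =
  trans (∑-single j _ (λ i j≢i → trans (cong (λ b → f i * (if b then c else + 0)) (dec-false (j ≟ i) j≢i))
                                       (*-zeroʳ (f i))))
        (cong (λ b → f j * (if b then c else + 0)) (dec-true (j ≟ j) refl))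

module _ {k l : ℕ} (M : Fin k → Fin l → ℤ) where

  apply-cong : ∀ {x y} → (∀ j → x j ≡ y j) → ∀ i → apply M x i ≡ apply M y i
  apply-cong x≡y i = ∑-cong (λ j → cong (M i j *_) (x≡y j))

  apply-zero : ∀ i → apply M (λ _ → + 0) i ≡ + 0
  apply-zero i = ∑-zero {f = λ j → M i j * + 0} (λ j → *-zeroʳ (M i j))

  apply-+ : ∀ x y i → apply M (λ j → x j + y j) i ≡ apply M x i + apply M y i
  apply-+ x y i = trans (∑-cong (λ j → *-distribˡ-+ (M i j) (x j) (y j)))
                        (∑-distrib-+ (λ j → M i j * x j) (λ j → M i j * y j))

  apply-- : ∀ x y i → apply M (λ j → x j - y j) i ≡ apply M x i - apply M y i
  apply-- x y i = trans (∑-cong (λ j → *-distribˡ-minus (M i j) (x j) (y j)))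
                        (∑-distrib-- (λ j → M i j * x j) (λ j → M i j * y j))

  apply-basis : ∀ j c i → apply M (basis j c) i ≡ M i j * c
  apply-basis j c i = ∑-basis (M i) j c

  apply-lincomb : ∀ {ℓ} (c : Fin ℓ → ℤ) b i → apply M (lincomb c b) i ≡ lincomb c (λ t → apply M (b t)) i
  apply-lincomb c b i = begin
    ∑ (λ j → M i j * ∑ (λ t → c t * b t j))     ≡⟨ ∑-cong (λ j → *-distribˡ-∑ (M i j) (λ t → c t * b t j)) ⟩
    ∑ (λ j → ∑ (λ t → M i j * (c t * b t j)))   ≡⟨ ∑-comm (λ j t → M i j * (c t * b t j)) ⟩
    ∑ (λ t → ∑ (λ j → M i j * (c t * b t j)))   ≡⟨ ∑-cong (λ t → ∑-cong (λ j → x*[y*z]≡y*[x*z] (M i j) (c t) (b t j))) ⟩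
    ∑ (λ t → ∑ (λ j → c t * (M i j * b t j)))   ≡⟨ ∑-cong (λ t → *-distribˡ-∑ (c t) (λ j → M i j * b t j)) ⟨
    ∑ (λ t → c t * apply M (b t) i)             ∎
    where
    open ≡-Reasoning
    x*[y*z]≡y*[x*z] : ∀ x y z → x * (y * z) ≡ y * (x * z)
    x*[y*z]≡y*[x*z] = solve-∀

  dot-apply-transpose : ∀ y u → dot y (apply (flip M) u) ≡ dot u (apply M y)
  dot-apply-transpose y u = begin
    ∑ (λ i → y i * ∑ (λ v → M v i * u v))       ≡⟨ ∑-cong (λ i → *-distribˡ-∑ (y i) (λ v → M v i * u v)) ⟩
    ∑ (λ i → ∑ (λ v → y i * (M v i * u v)))     ≡⟨ ∑-comm (λ i v → y i * (M v i * u v)) ⟩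
    ∑ (λ v → ∑ (λ i → y i * (M v i * u v)))     ≡⟨ ∑-cong (λ v → ∑-cong (λ i → x*[y*z]≡z*[y*x] (y i) (M v i) (u v))) ⟩
    ∑ (λ v → ∑ (λ i → u v * (M v i * y i)))     ≡⟨ ∑-cong (λ v → *-distribˡ-∑ (u v) (λ i → M v i * y i)) ⟨
    ∑ (λ v → u v * apply M y v)                 ∎
    where
    open ≡-Reasoning
    x*[y*z]≡z*[y*x] : ∀ x y z → x * (y * z) ≡ z * (y * x)
    x*[y*z]≡z*[y*x] = solve-∀

  apply-gram : ∀ x i → apply (gram M) x i ≡ apply (flip M) (apply M x) i
  apply-gram x i = begin
    ∑ (λ j → ∑ (λ v → M v i * M v j) * x j)     ≡⟨ ∑-cong (λ j → *-distribʳ-∑ (x j) (λ v → M v i * M v j)) ⟩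
    ∑ (λ j → ∑ (λ v → M v i * M v j * x j))     ≡⟨ ∑-comm (λ j v → M v i * M v j * x j) ⟩
    ∑ (λ v → ∑ (λ j → M v i * M v j * x j))     ≡⟨ ∑-cong (λ v → ∑-cong (λ j → *-assoc (M v i) (M v j) (x j))) ⟩
    ∑ (λ v → ∑ (λ j → M v i * (M v j * x j)))   ≡⟨ ∑-cong (λ v → *-distribˡ-∑ (M v i) (λ j → M v j * x j)) ⟨
    ∑ (λ v → M v i * apply M x v)               ∎
    where open ≡-Reasoning

  -- The quadratic form of a Gram matrix is a sum of squares.
  gram-kernel : ∀ x → (∀ i → apply (gram M) x i ≡ + 0) → ∀ v → apply M x v ≡ + 0
  gram-kernel x Gx≡0 = ∑-squares≡0 (apply M x) (begin
    dot (apply M x) (apply M x)           ≡⟨ dot-apply-transpose x (apply M x) ⟨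
    dot x (apply (flip M) (apply M x))    ≡⟨ ∑-cong (λ i → cong (x i *_) (trans (sym (apply-gram x i)) (Gx≡0 i))) ⟩
    ∑ (λ i → x i * + 0)                   ≡⟨ ∑-zero (λ i → *-zeroʳ (x i)) ⟩
    + 0                                   ∎)
    where open ≡-Reasoning

module _ {k : ℕ} where

  dot-congʳ : ∀ x {y z : Fin k → ℤ} → (∀ i → y i ≡ z i) → dot x y ≡ dot x z
  dot-congʳ x y≡z = ∑-cong (λ i → cong (x i *_) (y≡z i))

  dot-zeroʳ : ∀ x {z : Fin k → ℤ} → (∀ i → z i ≡ + 0) → dot x z ≡ + 0
  dot-zeroʳ x z≡0 = trans (dot-congʳ x z≡0) (∑-zero (λ i → *-zeroʳ (x i)))

  dot-zeroˡ : ∀ (z : Fin k → ℤ) → dot (λ _ → + 0) z ≡ + 0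
  dot-zeroˡ z = ∑-zero {f = λ i → + 0 * z i} (λ _ → refl)

  dot-+ˡ : ∀ x y (z : Fin k → ℤ) → dot (λ i → x i + y i) z ≡ dot x z + dot y z
  dot-+ˡ x y z = trans (∑-cong (λ i → *-distribʳ-+ (z i) (x i) (y i))) (∑-distrib-+ (λ i → x i * z i) (λ i → y i * z i))

  dot--ˡ : ∀ x y (z : Fin k → ℤ) → dot (λ i → x i - y i) z ≡ dot x z - dot y z
  dot--ˡ x y z = trans (∑-cong (λ i → [x-y]*z≡x*z-y*z (x i) (y i) (z i))) (∑-distrib-- (λ i → x i * z i) (λ i → y i * z i))
    where
    [x-y]*z≡x*z-y*z : ∀ x y z → (x - y) * z ≡ x * z - y * z
    [x-y]*z≡x*z-y*z = solve-∀

  dot-basisˡ : ∀ j c (z : Fin k → ℤ) → dot (basis j c) z ≡ z j * c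
  dot-basisˡ j c z = trans (∑-cong (λ i → *-comm (basis j c i) (z i))) (∑-basis z j c)

  dot-apply : ∀ (M : Fin k → Fin k → ℤ) y x → ∑ (λ i → ∑ (λ j → y i * (M i j * x j))) ≡ dot y (apply M x)
  dot-apply M y x = ∑-cong (λ i → sym (*-distribˡ-∑ (y i) (λ j → M i j * x j)))

  dot-symmetrize : ∀ (N M : Fin k → Fin k → ℤ) → (∀ i j → N i j + N j i ≡ M i j) →
                   ∀ a x → dot a (apply N x) + dot x (apply N a) ≡ dot a (apply M x)
  dot-symmetrize N M N+Nᵀ≡M a x = begin
    dot a (apply N x) + dot x (apply N a)
      ≡⟨ cong₂ _+_ (dot-apply N a x) (trans (∑-comm (λ i j → x j * (N j i * a i))) (dot-apply N x a)) ⟨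
    ∑ (λ i → ∑ (λ j → a i * (N i j * x j))) + ∑ (λ i → ∑ (λ j → x j * (N j i * a i)))
      ≡⟨ trans (∑-cong (λ i → ∑-distrib-+ (λ j → a i * (N i j * x j)) (λ j → x j * (N j i * a i))))
               (∑-distrib-+ (λ i → ∑ (λ j → a i * (N i j * x j))) (λ i → ∑ (λ j → x j * (N j i * a i)))) ⟨
    ∑ (λ i → ∑ (λ j → a i * (N i j * x j) + x j * (N j i * a i)))
      ≡⟨ ∑-cong (λ i → ∑-cong (λ j → trans (collect (a i) (x j) (N i j) (N j i))
                                            (cong (λ g → a i * (g * x j)) (N+Nᵀ≡M i j)))) ⟩
    ∑ (λ i → ∑ (λ j → a i * (M i j * x j)))
      ≡⟨ dot-apply M a x ⟩
    dot a (apply M x) ∎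
    where
    open ≡-Reasoning
    collect : ∀ a x g h → a * (g * x) + x * (h * a) ≡ a * ((g + h) * x)
    collect = solve-∀

  unitriangular-kernel : ∀ (N : Fin k → Fin k → ℤ) → (∀ i → N i i ≡ + 1) → (∀ i j → j Fin.< i → N i j ≡ + 0) →
                         ∀ z → (∀ i → apply N z i ≡ + 0) → ∀ i → z i ≡ + 0
  unitriangular-kernel N diag lower z Nz≡0 = All.wfRec >-wellFounded _ (λ i → z i ≡ + 0) step
    where
    step : ∀ i → (∀ {j} → i Fin.< j → z j ≡ + 0) → z i ≡ + 0
    step i above = begin
      z i                 ≡⟨ *-identityˡ (z i) ⟨
      + 1 * z i           ≡⟨ cong (_* z i) (diag i) ⟨
      N i i * z i         ≡⟨ ∑-single i (λ j → N i j * z j) off-diagonal ⟨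
      apply N z i         ≡⟨ Nz≡0 i ⟩
      + 0                 ∎
      where
      open ≡-Reasoning
      off-diagonal : ∀ j → ¬ (i ≡ j) → N i j * z j ≡ + 0
      off-diagonal j i≢j with FinP.<-cmp i j
      ... | tri< i<j _ _ = trans (cong (N i j *_) (above i<j)) (*-zeroʳ (N i j))
      ... | tri≈ _ i≡j _ = ⊥-elim (i≢j i≡j)
      ... | tri> _ _ j<i = cong (_* z j) (lower i j j<i)

module _ {A : Set} (f : A → A) where

  iter-+ : ∀ a b w → iter f (a ℕ.+ b) w ≡ iter f a (iter f b w)
  iter-+ zero b w = refl
  iter-+ (suc a) b w = cong f (iter-+ a b w)

  iter-suc : ∀ k w → iter f k (f w) ≡ iter f (suc k) w
  iter-suc zero w = refl
  iter-suc (suc k) w = cong f (iter-suc k w)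

  module _ {p : ℕ} {w : A} (period : iter f p w ≡ w) where

    iter-* : ∀ q → iter f (q ℕ.* p) w ≡ w
    iter-* zero = refl
    iter-* (suc q) = trans (iter-+ p (q ℕ.* p) w) (trans (cong (iter f p) (iter-* q)) period)

    iter-% : .{{_ : NonZero p}} → ∀ k → iter f (k % p) w ≡ iter f k w
    iter-% k = begin
      iter f (k % p) w                          ≡⟨ cong (iter f (k % p)) (iter-* (k / p)) ⟨
      iter f (k % p) (iter f (k / p ℕ.* p) w)   ≡⟨ iter-+ (k % p) (k / p ℕ.* p) w ⟨
      iter f (k % p ℕ.+ k / p ℕ.* p) w          ≡⟨ cong (λ j → iter f j w) (m≡m%n+[m/n]*n k p) ⟨
      iter f k w                                ∎
      where open ≡-Reasoning

    iter-returns : 1 ≤ p → ∀ k → ∃[ d ] iter f d (iter f k w) ≡ w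
    iter-returns 1≤p k = d , (begin
      iter f d (iter f k w)   ≡⟨ iter-+ d k w ⟨
      iter f (d ℕ.+ k) w      ≡⟨ cong (λ j → iter f j w) (ℕP.m∸n+n≡m k≤k*p) ⟩
      iter f (k ℕ.* p) w      ≡⟨ iter-* k ⟩
      w                       ∎)
      where
      open ≡-Reasoning
      d : ℕ
      d = k ℕ.* p ℕ.∸ k
      k≤k*p : k ≤ k ℕ.* p
      k≤k*p = ℕP.m≤m*n k p {{ℕ.>-nonZero 1≤p}}

    module _ (minimal : ∀ k → 0 < k → k < p → ¬ (iter f k w ≡ w)) where

      iter-<-injective : ∀ {r r'} → r < r' → r' < p → ¬ (iter f r w ≡ iter f r' w)
      iter-<-injective {r} {r'} r<r' r'<p r≡r' = minimal (d ℕ.+ r) 0<d+r d+r<p (begin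
        iter f (d ℕ.+ r) w      ≡⟨ iter-+ d r w ⟩
        iter f d (iter f r w)   ≡⟨ cong (iter f d) r≡r' ⟩
        iter f d (iter f r' w)  ≡⟨ iter-+ d r' w ⟨
        iter f (d ℕ.+ r') w     ≡⟨ cong (λ j → iter f j w) d+r'≡p ⟩
        iter f p w              ≡⟨ period ⟩
        w                       ∎)
        where
        open ≡-Reasoning
        d : ℕ
        d = p ℕ.∸ r'
        d+r'≡p : d ℕ.+ r' ≡ p
        d+r'≡p = ℕP.m∸n+n≡m (ℕP.<⇒≤ r'<p)
        0<d+r : 0 < d ℕ.+ r
        0<d+r = ℕP.<-≤-trans (ℕP.m<n⇒0<n∸m r'<p) (ℕP.m≤m+n d r)
        d+r<p : d ℕ.+ r < p
        d+r<p = ℕP.<-≤-trans (ℕP.+-monoʳ-< d r<r') (ℕP.≤-reflexive d+r'≡p)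

      iter-injective : ∀ {r r'} → r < p → r' < p → iter f r w ≡ iter f r' w → r ≡ r'
      iter-injective {r} {r'} r<p r'<p r≡r' with ℕP.<-cmp r r'
      ... | tri< r<r' _ _ = ⊥-elim (iter-<-injective r<r' r'<p r≡r')
      ... | tri≈ _ r≡r' _ = r≡r'
      ... | tri> _ _ r'<r = ⊥-elim (iter-<-injective r'<r r<p (sym r≡r'))

least : ∀ {N} {P : Fin N → Set} → (∀ k → Dec (P k)) → ∀ {k₀} → P k₀ →
        ∃[ k ] P k × (∀ k' → P k' → k Fin.≤ k')
least P? {Fin.zero} p₀ = Fin.zero , p₀ , λ _ _ → z≤n
least P? {Fin.suc k₀} pk₀ with P? Fin.zero
... | yes p₀ = Fin.zero , p₀ , λ _ _ → z≤n
... | no ¬p₀ with least (P? ∘ Fin.suc) pk₀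
...   | k , pk , below = Fin.suc k , pk , λ { Fin.zero p₀ → ⊥-elim (¬p₀ p₀) ; (Fin.suc k') pk' → s≤s (below k' pk') }

greatest : ∀ {N} {P : Fin N → Set} → (∀ k → Dec (P k)) → ∀ {k₀} → P k₀ →
           ∃[ k ] P k × (∀ k' → P k' → k' Fin.≤ k)
greatest {suc N} P? {k₀} pk₀ with FinP.any? (P? ∘ Fin.suc)
... | yes (k₁ , pk₁) with greatest (P? ∘ Fin.suc) pk₁
...   | k , pk , above = Fin.suc k , pk , λ { Fin.zero _ → z≤n ; (Fin.suc k') pk' → s≤s (above k' pk') }
greatest {suc N} P? {Fin.zero} p₀ | no none = Fin.zero , p₀ , λ { Fin.zero _ → z≤n ; (Fin.suc k') pk' → ⊥-elim (none (k' , pk')) }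
greatest {suc N} P? {Fin.suc k₀} pk₀ | no none = ⊥-elim (none (k₀ , pk₀))

another : ∀ {k} → 2 ≤ k → (v : Fin k) → ∃[ w ] ¬ (v ≡ w)
another (s≤s (s≤s _)) Fin.zero = Fin.suc Fin.zero , λ ()
another (s≤s (s≤s _)) (Fin.suc v) = Fin.zero , λ ()

module Incidence (Q : Quiver) where
  open Quiver Q renaming (s to src; t to tgt)

  δ-refl : ∀ v → δ Q v v ≡ + 1
  δ-refl v = cong (λ b → if b then + 1 else + 0) (dec-true (v ≟ v) refl)

  δ-≢ : ∀ {u v} → ¬ (u ≡ v) → δ Q u v ≡ + 0
  δ-≢ {u} {v} u≢v = cong (λ b → if b then + 1 else + 0) (dec-false (u ≟ v) u≢v)

  ∑-*δ-minus : ∀ (F : Fin m → ℤ) a b → ∑ (λ v → F v * (δ Q a v - δ Q b v)) ≡ F a - F b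
  ∑-*δ-minus F a b = begin
    ∑ (λ v → F v * (δ Q a v - δ Q b v))                   ≡⟨ ∑-cong (λ v → *-distribˡ-minus (F v) (δ Q a v) (δ Q b v)) ⟩
    ∑ (λ v → F v * δ Q a v - F v * δ Q b v)               ≡⟨ ∑-distrib-- (λ v → F v * δ Q a v) (λ v → F v * δ Q b v) ⟩
    ∑ (λ v → F v * δ Q a v) - ∑ (λ v → F v * δ Q b v)     ≡⟨ cong₂ _-_ (∑-basis F a (+ 1)) (∑-basis F b (+ 1)) ⟩
    F a * + 1 - F b * + 1                                 ≡⟨ cong₂ _-_ (*-identityʳ (F a)) (*-identityʳ (F b)) ⟩
    F a - F b                                             ∎
    where open ≡-Reasoning

  ∂ : (Fin n → ℤ) → Fin m → ℤ
  ∂ = apply (Inc Q)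

  coboundary : (Fin m → ℤ) → Fin n → ℤ
  coboundary u i = u (src i) - u (tgt i)

  apply-Incᵀ : ∀ u i → apply (flip (Inc Q)) u i ≡ coboundary u i
  apply-Incᵀ u i = trans (∑-cong (λ v → *-comm (Inc Q v i) (u v))) (∑-*δ-minus u (src i) (tgt i))

  dot-coboundary : ∀ y u → dot y (coboundary u) ≡ dot u (∂ y)
  dot-coboundary y u = trans (dot-congʳ y (λ i → sym (apply-Incᵀ u i))) (dot-apply-transpose (Inc Q) y u)

  apply-G : ∀ x i → apply (G Q) x i ≡ coboundary (∂ x) i
  apply-G x i = trans (apply-gram (Inc Q) x i) (apply-Incᵀ (∂ x) i)

  ∂≡0⇒InRad : ∀ x → (∀ v → ∂ x v ≡ + 0) → InRad Q x
  ∂≡0⇒InRad x ∂x≡0 i = trans (apply-G x i) (cong₂ _-_ (∂x≡0 (src i)) (∂x≡0 (tgt i)))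

  InRad⇒∂≡0 : ∀ x → InRad Q x → ∀ v → ∂ x v ≡ + 0
  InRad⇒∂≡0 = gram-kernel (Inc Q)

  inc-++ : ∀ xs ys a → inc Q (xs ++ ys) a ≡ inc Q xs a + inc Q ys a
  inc-++ [] ys a = sym (+-identityˡ _)
  inc-++ ((j , ε) ∷ xs) ys a = trans (cong (_+_ (basis j (sign Q ε) a)) (inc-++ xs ys a))
                                     (sym (+-assoc (basis j (sign Q ε) a) _ _))

  ValidWalk-++ : ∀ a xs ys → ValidWalk Q a xs → ValidWalk Q (walkTarget Q a xs) ys → ValidWalk Q a (xs ++ ys)
  ValidWalk-++ a [] ys _ valid-ys = valid-ys
  ValidWalk-++ a (x ∷ xs) ys (e , valid-xs) valid-ys = e , ValidWalk-++ (stepEnd Q x) xs ys valid-xs valid-ys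

  walkTarget-++ : ∀ a xs ys → walkTarget Q a (xs ++ ys) ≡ walkTarget Q (walkTarget Q a xs) ys
  walkTarget-++ a [] ys = refl
  walkTarget-++ a (x ∷ xs) ys = walkTarget-++ (stepEnd Q x) xs ys

  Inc-step : ∀ (x : Step Q) v → Inc Q v (proj₁ x) * sign Q (proj₂ x) ≡ δ Q (stepStart Q x) v - δ Q (stepEnd Q x) v
  Inc-step (j , true) v = *-identityʳ _
  Inc-step (j , false) v = [a-b]*-1≡b-a (δ Q (src j) v) (δ Q (tgt j) v)
    where
    [a-b]*-1≡b-a : ∀ a b → (a - b) * - (+ 1) ≡ b - a
    [a-b]*-1≡b-a = solve-∀

  ∂-inc : ∀ a ws → ValidWalk Q a ws → ∀ v → ∂ (inc Q ws) v ≡ δ Q a v - δ Q (walkTarget Q a ws) v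
  ∂-inc a [] _ v = trans (apply-zero (Inc Q) v) (sym (+-inverseʳ (δ Q a v)))
  ∂-inc .(stepStart Q x) (x ∷ ws) (refl , valid) v = begin
    ∂ (λ i → basis (proj₁ x) (sign Q (proj₂ x)) i + inc Q ws i) v
      ≡⟨ apply-+ (Inc Q) (basis (proj₁ x) (sign Q (proj₂ x))) (inc Q ws) v ⟩
    ∂ (basis (proj₁ x) (sign Q (proj₂ x))) v + ∂ (inc Q ws) v
      ≡⟨ cong₂ _+_ (trans (apply-basis (Inc Q) (proj₁ x) (sign Q (proj₂ x)) v) (Inc-step x v))
                   (∂-inc (stepEnd Q x) ws valid v) ⟩
    (δ Q (stepStart Q x) v - δ Q (stepEnd Q x) v) + (δ Q (stepEnd Q x) v - δ Q (walkTarget Q (stepEnd Q x) ws) v)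
      ≡⟨ +-minus-telescope (δ Q (stepStart Q x) v) (δ Q (stepEnd Q x) v) (δ Q (walkTarget Q (stepEnd Q x) ws) v) ⟩
    δ Q (stepStart Q x) v - δ Q (walkTarget Q (stepEnd Q x) ws) v ∎
    where open ≡-Reasoning

  dot-inc-coboundary : ∀ a ws → ValidWalk Q a ws → ∀ u → dot (inc Q ws) (coboundary u) ≡ u a - u (walkTarget Q a ws)
  dot-inc-coboundary a ws valid u =
    trans (dot-coboundary (inc Q ws) u) (trans (dot-congʳ u (∂-inc a ws valid)) (∑-*δ-minus u a (walkTarget Q a ws)))

  coboundary≡0⇒constant : Connected Q → ∀ u → (∀ i → coboundary u i ≡ + 0) → ∀ a v → u a ≡ u v
  coboundary≡0⇒constant connected u du≡0 a v with connected a v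
  ... | ws , valid , refl =
    i-j≡0⇒i≡j (u a) _ (trans (sym (dot-inc-coboundary a ws valid u)) (dot-zeroʳ (inc Q ws) du≡0))

  dot-inc-arrow : ∀ k z → dot (inc Q ((k , true) ∷ [])) z ≡ z k
  dot-inc-arrow k z = begin
    dot (λ i → basis k (+ 1) i + + 0) z         ≡⟨ dot-+ˡ (basis k (+ 1)) (λ _ → + 0) z ⟩
    dot (basis k (+ 1)) z + dot (λ _ → + 0) z   ≡⟨ cong₂ _+_ (dot-basisˡ k (+ 1) z) (dot-zeroˡ z) ⟩
    z k * + 1 + + 0                             ≡⟨ trans (+-identityʳ _) (*-identityʳ (z k)) ⟩
    z k                                         ∎
    where open ≡-Reasoning

  module _ (z : Fin n → ℤ) (z⊥rad : ∀ y → InRad Q y → dot y z ≡ + 0) where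

    dot-inc-pathIndependent : ∀ a ws ws' → ValidWalk Q a ws → ValidWalk Q a ws' →
                              walkTarget Q a ws ≡ walkTarget Q a ws' → dot (inc Q ws) z ≡ dot (inc Q ws') z
    dot-inc-pathIndependent a ws ws' valid valid' sameTarget =
      i-j≡0⇒i≡j _ _ (trans (sym (dot--ˡ (inc Q ws) (inc Q ws') z)) (z⊥rad _ (∂≡0⇒InRad _ ∂≡0)))
      where
      ∂≡0 : ∀ v → ∂ (λ i → inc Q ws i - inc Q ws' i) v ≡ + 0
      ∂≡0 v = begin
        ∂ (λ i → inc Q ws i - inc Q ws' i) v
          ≡⟨ apply-- (Inc Q) (inc Q ws) (inc Q ws') v ⟩
        ∂ (inc Q ws) v - ∂ (inc Q ws') v
          ≡⟨ cong₂ _-_ (∂-inc a ws valid v) (∂-inc a ws' valid' v) ⟩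
        (δ Q a v - δ Q (walkTarget Q a ws) v) - (δ Q a v - δ Q (walkTarget Q a ws') v)
          ≡⟨ cong (λ b → (δ Q a v - δ Q (walkTarget Q a ws) v) - (δ Q a v - δ Q b v)) sameTarget ⟨
        (δ Q a v - δ Q (walkTarget Q a ws) v) - (δ Q a v - δ Q (walkTarget Q a ws) v)
          ≡⟨ +-inverseʳ (δ Q a v - δ Q (walkTarget Q a ws) v) ⟩
        + 0 ∎
        where open ≡-Reasoning

    -- The potential of a vertex v is minus the integral of z along a fixed path from b₀ to v.
    orthogonal⇒coboundary : Connected Q → ∀ b₀ → ∃[ u ] u b₀ ≡ + 0 × (∀ i → z i ≡ coboundary u i)
    orthogonal⇒coboundary connected b₀ = u , u[b₀]≡0 , z≡du
      where
      path : Fin m → List (Step Q)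
      path v = proj₁ (connected b₀ v)
      valid : ∀ v → ValidWalk Q b₀ (path v)
      valid v = proj₁ (proj₂ (connected b₀ v))
      target : ∀ v → walkTarget Q b₀ (path v) ≡ v
      target v = proj₂ (proj₂ (connected b₀ v))

      u : Fin m → ℤ
      u v = - dot (inc Q (path v)) z

      u[b₀]≡0 : u b₀ ≡ + 0
      u[b₀]≡0 = cong -_ (trans (dot-inc-pathIndependent b₀ (path b₀) [] (valid b₀) tt (target b₀)) (dot-zeroˡ z))

      z≡du : ∀ k → z k ≡ coboundary u k
      z≡du k = begin
        z k                                         ≡⟨ x≡[a+x]-a (dot (inc Q (path (src k))) z) (z k) ⟩
        dot (inc Q (path (src k))) z + z k - dot (inc Q (path (src k))) z
          ≡⟨ cong (_- dot (inc Q (path (src k))) z) detour≡direct ⟩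
        dot (inc Q (path (tgt k))) z - dot (inc Q (path (src k))) z
          ≡⟨ a-b≡-b--a (dot (inc Q (path (tgt k))) z) (dot (inc Q (path (src k))) z) ⟩
        u (src k) - u (tgt k)                       ∎
        where
        open ≡-Reasoning
        x≡[a+x]-a : ∀ a x → x ≡ a + x - a
        x≡[a+x]-a = solve-∀
        a-b≡-b--a : ∀ a b → a - b ≡ - b - - a
        a-b≡-b--a = solve-∀
        detour : List (Step Q)
        detour = path (src k) ++ (k , true) ∷ []
        detour≡direct : dot (inc Q (path (src k))) z + z k ≡ dot (inc Q (path (tgt k))) z
        detour≡direct = begin
          dot (inc Q (path (src k))) z + z k
            ≡⟨ cong (_+_ (dot (inc Q (path (src k))) z)) (dot-inc-arrow k z) ⟨
          dot (inc Q (path (src k))) z + dot (inc Q ((k , true) ∷ [])) z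
            ≡⟨ dot-+ˡ (inc Q (path (src k))) (inc Q ((k , true) ∷ [])) z ⟨
          dot (λ i → inc Q (path (src k)) i + inc Q ((k , true) ∷ []) i) z
            ≡⟨ ∑-cong (λ i → cong (_* z i) (inc-++ (path (src k)) ((k , true) ∷ []) i)) ⟨
          dot (inc Q detour) z
            ≡⟨ dot-inc-pathIndependent b₀ detour (path (tgt k))
                 (ValidWalk-++ b₀ (path (src k)) _ (valid (src k)) (sym (target (src k)) , tt)) (valid (tgt k))
                 (trans (walkTarget-++ b₀ (path (src k)) _) (sym (target (tgt k)))) ⟩
          dot (inc Q (path (tgt k))) z ∎

  visits : (Fin m → Fin m) → Fin m → ℕ → Fin m → ℤ
  visits f w zero v = + 0
  visits f w (suc k) v = δ Q v w + visits f (f w) k v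

  module _ (f : Fin m → Fin m) where

    visits-≡0 : ∀ k w v → (∀ r → r < k → ¬ (iter f r w ≡ v)) → visits f w k v ≡ + 0
    visits-≡0 zero w v never = refl
    visits-≡0 (suc k) w v never =
      cong₂ _+_ (δ-≢ (λ v≡w → never 0 (s≤s z≤n) (sym v≡w)))
                (visits-≡0 k (f w) v (λ r r<k hit → never (suc r) (s≤s r<k) (trans (sym (iter-suc f r w)) hit)))

    visits-≡1 : ∀ k w v r₀ → r₀ < k → iter f r₀ w ≡ v → (∀ r → r < k → iter f r w ≡ v → r ≡ r₀) →
                visits f w k v ≡ + 1
    visits-≡1 (suc k) w .w zero _ refl unique =
      cong₂ _+_ (δ-refl w)
        (visits-≡0 k (f w) w (λ r r<k hit → ℕP.1+n≢0 (unique (suc r) (s≤s r<k) (trans (sym (iter-suc f r w)) hit))))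
    visits-≡1 (suc k) w v (suc r₀) (s≤s r₀<k) hit unique =
      trans (cong₂ _+_ (δ-≢ (λ v≡w → ℕP.1+n≢0 (sym (unique 0 (s≤s z≤n) (sym v≡w)))))
                       (visits-≡1 k (f w) v r₀ r₀<k (trans (iter-suc f r₀ w) hit)
                          (λ r r<k hit' → ℕP.suc-injective (unique (suc r) (s≤s r<k) (trans (sym (iter-suc f r w)) hit')))))
            (+-identityˡ (+ 1))

    visits-orbit : ∀ {p w} → iter f p w ≡ w → 1 ≤ p → (∀ k → 0 < k → k < p → ¬ (iter f k w ≡ w)) →
                   ∀ k → visits f w p (iter f k w) ≡ + 1
    visits-orbit {p} {w} period 1≤p minimal k =
      visits-≡1 p w (iter f k w) (k % p) (m%n<n k p) (iter-% f period k)
        (λ r r<p hit → iter-injective f period minimal r<p (m%n<n k p) (trans hit (sym (iter-% f period k))))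
      where
      instance
        p≢0 : NonZero p
        p≢0 = ℕ.>-nonZero 1≤p

  Incident-stepStart : ∀ (x : Step Q) → Incident Q (proj₁ x) (stepStart Q x)
  Incident-stepStart (k , true) = inj₁ refl
  Incident-stepStart (k , false) = inj₂ refl

  incidentArrow : Connected Q → 2 ≤ m → ∀ v → ∃[ k ] Incident Q k v
  incidentArrow connected 2≤m v with another 2≤m v
  ... | w , v≢w with connected v w
  ...   | [] , _ , v≡w = ⊥-elim (v≢w v≡w)
  ...   | x ∷ _ , (start≡v , _) , _ = proj₁ x , subst (Incident Q (proj₁ x)) start≡v (Incident-stepStart x)

module Triangular (Q : Quiver) (loopless : Loopless Q) where
  open Quiver Q renaming (s to src; t to tgt)
  open Incidence Q

  Inc-stepStart : ∀ (x : Step Q) → Inc Q (stepStart Q x) (proj₁ x) ≡ sign Q (proj₂ x)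
  Inc-stepStart (j , true) rewrite δ-refl (src j) | δ-≢ {tgt j} {src j} (λ e → loopless j (sym e)) = refl
  Inc-stepStart (j , false) rewrite δ-refl (tgt j) | δ-≢ {src j} {tgt j} (loopless j) = refl

  G-step : ∀ k (x : Step Q) → G Q k (proj₁ x) * sign Q (proj₂ x) ≡ Inc Q (stepStart Q x) k - Inc Q (stepEnd Q x) k
  G-step k x = begin
    ∑ (λ v → Inc Q v k * Inc Q v (proj₁ x)) * sign Q (proj₂ x)
      ≡⟨ *-distribʳ-∑ (sign Q (proj₂ x)) (λ v → Inc Q v k * Inc Q v (proj₁ x)) ⟩
    ∑ (λ v → Inc Q v k * Inc Q v (proj₁ x) * sign Q (proj₂ x))
      ≡⟨ ∑-cong (λ v → trans (*-assoc (Inc Q v k) _ _) (cong (Inc Q v k *_) (Inc-step x v))) ⟩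
    ∑ (λ v → Inc Q v k * (δ Q (stepStart Q x) v - δ Q (stepEnd Q x) v))
      ≡⟨ ∑-*δ-minus (λ v → Inc Q v k) (stepStart Q x) (stepEnd Q x) ⟩
    Inc Q (stepStart Q x) k - Inc Q (stepEnd Q x) k ∎
    where open ≡-Reasoning

  G-diag : ∀ i → G Q i i ≡ + 2
  G-diag i = trans (sym (*-identityʳ (G Q i i)))
                   (trans (G-step i (i , true)) (cong₂ _-_ (Inc-stepStart (i , true)) (Inc-stepStart (i , false))))

  Gˇ-< : ∀ {i j} → i Fin.< j → Gˇ Q i j ≡ G Q i j
  Gˇ-< {i} {j} i<j rewrite dec-true (i Fin.<? j) i<j = refl

  Gˇ-diag : ∀ i → Gˇ Q i i ≡ + 1
  Gˇ-diag i rewrite dec-false (i Fin.<? i) (ℕP.<-irrefl refl) | dec-true (i ≟ i) refl = refl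

  Gˇ-> : ∀ {i j} → j Fin.< i → Gˇ Q i j ≡ + 0
  Gˇ-> {i} {j} j<i rewrite dec-false (i Fin.<? j) (ℕP.<-asym j<i)
                         | dec-false (i ≟ j) (λ i≡j → ℕP.<-irrefl (cong Fin.toℕ (sym i≡j)) j<i) = refl

  Gˇ+Gˇᵀ≡G : ∀ i j → Gˇ Q i j + Gˇ Q j i ≡ G Q i j
  Gˇ+Gˇᵀ≡G i j with FinP.<-cmp i j
  ... | tri< i<j _ _ rewrite Gˇ-< i<j | Gˇ-> i<j = +-identityʳ _
  ... | tri≈ _ refl _ rewrite Gˇ-diag i | G-diag i = refl
  ... | tri> _ _ j<i rewrite Gˇ-< j<i | Gˇ-> j<i = trans (+-identityˡ (G Q j i)) (∑-cong (λ v → *-comm (Inc Q v j) (Inc Q v i)))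

  Gˇ-kernel : ∀ z → (∀ i → apply (Gˇ Q) z i ≡ + 0) → ∀ i → z i ≡ + 0
  Gˇ-kernel = unitriangular-kernel (Gˇ Q) Gˇ-diag (λ i j j<i → Gˇ-> j<i)

module StructuralWalks (Q : Quiver) (loopless : Loopless Q) where
  open Quiver Q renaming (s to src; t to tgt)
  open Incidence Q
  open Triangular Q loopless

  Incident? : ∀ k v → Dec (Incident Q k v)
  Incident? k v = (src k ≟ v) ⊎-dec (tgt k ≟ v)

  Inc-nonincident : ∀ {k v} → ¬ Incident Q k v → Inc Q v k ≡ + 0
  Inc-nonincident {k} {v} ¬inc rewrite δ-≢ {src k} {v} (¬inc ∘ inj₁) | δ-≢ {tgt k} {v} (¬inc ∘ inj₂) = refl

  incomingStep : ∀ {k v} → Incident Q k v → ∃[ d ] stepEnd Q (k , d) ≡ v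
  incomingStep (inj₁ src≡v) = false , src≡v
  incomingStep (inj₂ tgt≡v) = true , tgt≡v

  outgoingStep : ∀ {k v} → Incident Q k v → ∃[ d ] stepStart Q (k , d) ≡ v
  outgoingStep (inj₁ src≡v) = true , src≡v
  outgoingStep (inj₂ tgt≡v) = false , tgt≡v

  lastStep : Step Q → List (Step Q) → Step Q
  lastStep x [] = x
  lastStep x (y ∷ ys) = lastStep y ys

  EndMinimal : Step Q → List (Step Q) → Set
  EndMinimal x ws = ∀ k → k Fin.< proj₁ (lastStep x ws) → ¬ Incident Q k (stepEnd Q (lastStep x ws))

  IsTruncatedRow : Fin m → Fin n → (Fin n → ℤ) → Set
  IsTruncatedRow a i R = ∀ k → (k Fin.≤ i → R k ≡ Inc Q a k) × (i Fin.< k → R k ≡ + 0)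

  applyGˇ-inc-cons : ∀ x ws →
    (∀ k → k Fin.< proj₁ x → apply (Gˇ Q) (inc Q ws) k ≡ Inc Q (stepEnd Q x) k) →
    (∀ k → proj₁ x Fin.≤ k → apply (Gˇ Q) (inc Q ws) k ≡ + 0) →
    IsTruncatedRow (stepStart Q x) (proj₁ x) (apply (Gˇ Q) (inc Q (x ∷ ws)))
  applyGˇ-inc-cons (i , ε) ws below above k
    rewrite apply-+ (Gˇ Q) (basis i (sign Q ε)) (inc Q ws) k | apply-basis (Gˇ Q) i (sign Q ε) k
    with FinP.<-cmp k i
  ... | tri< k<i _ _ rewrite Gˇ-< k<i | G-step k (i , ε) | below k k<i =
        (λ _ → x-y+y≡x (Inc Q (stepStart Q (i , ε)) k) _) , λ i<k → ⊥-elim (ℕP.<-asym k<i i<k)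
    where
    x-y+y≡x : ∀ x y → x - y + y ≡ x
    x-y+y≡x = solve-∀
  ... | tri≈ _ refl _ rewrite Gˇ-diag k | above k ℕP.≤-refl =
        (λ _ → trans (+-identityʳ _) (trans (*-identityˡ _) (sym (Inc-stepStart (k , ε))))) ,
        λ k<k → ⊥-elim (ℕP.<-irrefl refl k<k)
  ... | tri> _ _ i<k rewrite Gˇ-> i<k | above k (ℕP.<⇒≤ i<k) =
        (λ k≤i → ⊥-elim (ℕP.<⇒≱ i<k k≤i)) , λ _ → refl

  applyGˇ-inc-descending : ∀ a x ws → ValidWalk Q a (x ∷ ws) → MinDescSteps Q (x ∷ ws) → EndMinimal x ws →
                           IsTruncatedRow a (proj₁ x) (apply (Gˇ Q) (inc Q (x ∷ ws)))
  applyGˇ-inc-descending .(stepStart Q x) x [] (refl , _) _ endMinimal =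
    applyGˇ-inc-cons x []
      (λ k k<i → trans (apply-zero (Gˇ Q) k) (sym (Inc-nonincident (endMinimal k k<i))))
      (λ k _ → apply-zero (Gˇ Q) k)
  applyGˇ-inc-descending .(stepStart Q x) x (y ∷ ws) (refl , valid) ((j<i , _ , jMax) , descending) endMinimal =
    applyGˇ-inc-cons x (y ∷ ws) below
      (λ k i≤k → proj₂ (rest k) (ℕP.<-≤-trans j<i i≤k))
    where
    rest : IsTruncatedRow (stepEnd Q x) (proj₁ y) (apply (Gˇ Q) (inc Q (y ∷ ws)))
    rest = applyGˇ-inc-descending (stepEnd Q x) y ws valid descending endMinimal
    below : ∀ k → k Fin.< proj₁ x → apply (Gˇ Q) (inc Q (y ∷ ws)) k ≡ Inc Q (stepEnd Q x) k
    below k k<i with k Fin.≤? proj₁ y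
    ... | yes k≤j = proj₁ (rest k) k≤j
    ... | no k≰j = trans (proj₂ (rest k) (ℕP.≰⇒> k≰j))
                         (sym (Inc-nonincident (λ kInc → k≰j (jMax k k<i kInc))))

  unextendable⇒EndMinimal : ∀ a x ws → ValidWalk Q a (x ∷ ws) → MinDescSteps Q (x ∷ ws) →
    (∀ y → ¬ MinimallyDescending Q a ((x ∷ ws) ++ y ∷ [])) → EndMinimal x ws
  unextendable⇒EndMinimal a (i , ε) [] (start≡a , _) _ unextendable k₀ k₀<i k₀Inc
    with greatest (λ k → (k Fin.<? i) ×-dec Incident? k (stepEnd Q (i , ε))) (k₀<i , k₀Inc)
  ... | k , (k<i , kInc) , kMax with outgoingStep kInc
  ...   | d , kStart = unextendable (k , d)
          ((start≡a , kStart , tt) , (k<i , kInc , λ k' k'<i k'Inc → kMax k' (k'<i , k'Inc)) , tt)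
  unextendable⇒EndMinimal a x (y ∷ ws) (start≡a , valid) (step , descending) unextendable =
    unextendable⇒EndMinimal (stepEnd Q x) y ws valid descending
      (λ z (valid' , descending') → unextendable z ((start≡a , valid') , (step , descending')))

  Structural⇒EndMinimal : ∀ v x ws → Structural Q v (x ∷ ws) → EndMinimal x ws
  Structural⇒EndMinimal v x ws ((valid , descending) , maximal) =
    unextendable⇒EndMinimal v x ws valid descending
      (λ y extended → case proj₂ (maximal v [] (y ∷ []) refl extended) of λ ())

  Structural⇒firstMaximal : ∀ v x ws → Structural Q v (x ∷ ws) → ∀ k → proj₁ x Fin.< k → ¬ Incident Q k v
  Structural⇒firstMaximal v (i , ε) ws ((valid , descending) , maximal) k₀ i<k₀ k₀Inc
    with least (λ k → (i Fin.<? k) ×-dec Incident? k v) (i<k₀ , k₀Inc)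
  ... | k , (i<k , kInc) , kMin with incomingStep kInc
  ...   | d , refl with maximal (stepStart Q (k , d)) ((k , d) ∷ []) [] refl prepended
    where
    prepended : MinimallyDescending Q (stepStart Q (k , d)) ((k , d) ∷ ((i , ε) ∷ ws) ++ [])
    prepended = subst (λ ws' → MinimallyDescending Q (stepStart Q (k , d)) ((k , d) ∷ ws'))
                      (sym (LP.++-identityʳ ((i , ε) ∷ ws)))
                      ((refl , valid) ,
                       (i<k , subst (Incident Q i) (proj₁ valid) (Incident-stepStart (i , ε)) ,
                        λ k' k'<k k'Inc → ℕP.≮⇒≥ (λ i<k' → ℕP.<⇒≱ k'<k (kMin k' (i<k' , k'Inc)))) ,
                       descending)
  ...     | () , _

  Structural-[]⇒isolated : ∀ v → Structural Q v [] → ∀ k → ¬ Incident Q k v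
  Structural-[]⇒isolated v (_ , maximal) k kInc with incomingStep kInc
  ... | d , end≡v with maximal (stepStart Q (k , d)) ((k , d) ∷ []) [] end≡v ((refl , tt) , tt)
  ...   | () , _

  applyGˇ-inc-structural : ∀ v ws → Structural Q v ws → ∀ {k₀} → Incident Q k₀ v →
                           ∀ k → apply (Gˇ Q) (inc Q ws) k ≡ Inc Q v k
  applyGˇ-inc-structural v [] S k₀Inc k = ⊥-elim (Structural-[]⇒isolated v S _ k₀Inc)
  applyGˇ-inc-structural v (x ∷ ws) S@((valid , descending) , _) _ k
    with k Fin.≤? proj₁ x | applyGˇ-inc-descending v x ws valid descending (Structural⇒EndMinimal v x ws S) k
  ... | yes k≤i | upTo , _ = upTo k≤i
  ... | no k≰i | _ , above = trans (above (ℕP.≰⇒> k≰i))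
                                   (sym (Inc-nonincident (Structural⇒firstMaximal v x ws S k (ℕP.≰⇒> k≰i))))

module OrbitBasis
  (Q : Quiver) (loopless : Loopless Q) (connected : Connected Q) (2≤m : 2 ≤ Quiver.m Q)
  (α : Fin (Quiver.m Q) → List (Step Q)) (structural : ∀ v → Structural Q v (α v))
  (ℓ : ℕ) (rep : Fin ℓ → Fin (Quiver.m Q)) (π : Fin ℓ → ℕ) (1≤π : ∀ t → 1 ≤ π t)
  (period : ∀ t → iter (ξ Q α) (π t) (rep t) ≡ rep t)
  (minimal : ∀ t k → 0 < k → k < π t → ¬ (iter (ξ Q α) k (rep t) ≡ rep t))
  (cover : ∀ v → Σ (Fin ℓ) λ t → Σ ℕ λ k → iter (ξ Q α) k (rep t) ≡ v)
  (distinct : ∀ t t' k → iter (ξ Q α) k (rep t) ≡ rep t' → t ≡ t')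
  where

  open Quiver Q renaming (s to src; t to tgt)
  open Incidence Q
  open Triangular Q loopless
  open StructuralWalks Q loopless

  applyGˇ-α : ∀ w i → apply (Gˇ Q) (inc Q (α w)) i ≡ Inc Q w i
  applyGˇ-α w = applyGˇ-inc-structural w (α w) (structural w) (proj₂ (incidentArrow connected 2≤m w))

  βSteps-walk : ∀ k w → ValidWalk Q w (βSteps Q α k w) × walkTarget Q w (βSteps Q α k w) ≡ iter (ξ Q α) k w
  βSteps-walk zero w = tt , refl
  βSteps-walk (suc k) w =
    ValidWalk-++ w (α w) _ (proj₁ (proj₁ (structural w))) (proj₁ (βSteps-walk k (ξ Q α w))) ,
    trans (walkTarget-++ w (α w) _) (trans (proj₂ (βSteps-walk k (ξ Q α w))) (iter-suc (ξ Q α) k w))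

  applyGˇ-βSteps : ∀ k w i → apply (Gˇ Q) (inc Q (βSteps Q α k w)) i ≡ coboundary (visits (ξ Q α) w k) i
  applyGˇ-βSteps zero w i = apply-zero (Gˇ Q) i
  applyGˇ-βSteps (suc k) w i = begin
    apply (Gˇ Q) (inc Q (α w ++ βSteps Q α k (ξ Q α w))) i
      ≡⟨ apply-cong (Gˇ Q) (inc-++ (α w) _) i ⟩
    apply (Gˇ Q) (λ j → inc Q (α w) j + inc Q (βSteps Q α k (ξ Q α w)) j) i
      ≡⟨ apply-+ (Gˇ Q) (inc Q (α w)) _ i ⟩
    apply (Gˇ Q) (inc Q (α w)) i + apply (Gˇ Q) (inc Q (βSteps Q α k (ξ Q α w))) i
      ≡⟨ cong₂ _+_ (applyGˇ-α w i) (applyGˇ-βSteps k (ξ Q α w) i) ⟩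
    (δ Q (src i) w - δ Q (tgt i) w) + (V (src i) - V (tgt i))
      ≡⟨ interchange (δ Q (src i) w) (δ Q (tgt i) w) (V (src i)) (V (tgt i)) ⟩
    coboundary (visits (ξ Q α) w (suc k)) i ∎
    where
    open ≡-Reasoning
    V : Fin m → ℤ
    V = visits (ξ Q α) (ξ Q α w) k
    interchange : ∀ a b c d → (a - b) + (c - d) ≡ (a + c) - (b + d)
    interchange = solve-∀

  b : Fin ℓ → Fin n → ℤ
  b t = inc Q (βSteps Q α (π t) (rep t))

  orbitIndicator : Fin ℓ → Fin m → ℤ
  orbitIndicator t = visits (ξ Q α) (rep t) (π t)

  orbitIndicator-own : ∀ t k → orbitIndicator t (iter (ξ Q α) k (rep t)) ≡ + 1
  orbitIndicator-own t = visits-orbit (ξ Q α) (period t) (1≤π t) (minimal t)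

  orbitIndicator-other : ∀ t t' k → ¬ (t ≡ t') → orbitIndicator t (iter (ξ Q α) k (rep t')) ≡ + 0
  orbitIndicator-other t t' k t≢t' = visits-≡0 (ξ Q α) (π t) (rep t) _ λ r _ same →
    let d , back = iter-returns (ξ Q α) (period t') (1≤π t') k in
    t≢t' (distinct t t' (d ℕ.+ r) (trans (iter-+ (ξ Q α) d r (rep t)) (trans (cong (iter (ξ Q α) d) same) back)))

  lincomb-orbitIndicator : ∀ c t k → lincomb c orbitIndicator (iter (ξ Q α) k (rep t)) ≡ c t
  lincomb-orbitIndicator c t k =
    trans (∑-single t _ (λ t' t≢t' → trans (cong (c t' *_) (orbitIndicator-other t' t k (t≢t' ∘ sym))) (*-zeroʳ (c t'))))
          (trans (cong (c t *_) (orbitIndicator-own t k)) (*-identityʳ (c t)))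

  applyGˇ-b : ∀ t i → apply (Gˇ Q) (b t) i ≡ coboundary (orbitIndicator t) i
  applyGˇ-b t = applyGˇ-βSteps (π t) (rep t)

  applyGˇ-lincomb-b : ∀ c i → apply (Gˇ Q) (lincomb c b) i ≡ coboundary (lincomb c orbitIndicator) i
  applyGˇ-lincomb-b c i = begin
    apply (Gˇ Q) (lincomb c b) i
      ≡⟨ apply-lincomb (Gˇ Q) c b i ⟩
    ∑ (λ t → c t * apply (Gˇ Q) (b t) i)
      ≡⟨ ∑-cong (λ t → trans (cong (c t *_) (applyGˇ-b t i)) (*-distribˡ-minus (c t) _ _)) ⟩
    ∑ (λ t → c t * orbitIndicator t (src i) - c t * orbitIndicator t (tgt i))
      ≡⟨ ∑-distrib-- (λ t → c t * orbitIndicator t (src i)) (λ t → c t * orbitIndicator t (tgt i)) ⟩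
    coboundary (lincomb c orbitIndicator) i ∎
    where open ≡-Reasoning

  b∈radRe : ∀ t → InRadRe Q (b t)
  b∈radRe t = ∂≡0⇒InRad (b t) ∂b≡0 , λ y y∈rad → begin
    bilinˇ Q y (b t)                  ≡⟨ dot-apply (Gˇ Q) y (b t) ⟩
    dot y (apply (Gˇ Q) (b t))        ≡⟨ dot-congʳ y (applyGˇ-b t) ⟩
    dot y (coboundary (orbitIndicator t))   ≡⟨ dot-coboundary y (orbitIndicator t) ⟩
    dot (orbitIndicator t) (∂ y)      ≡⟨ dot-zeroʳ (orbitIndicator t) (InRad⇒∂≡0 y y∈rad) ⟩
    + 0                               ∎
    where
    open ≡-Reasoning
    walk : ValidWalk Q (rep t) (βSteps Q α (π t) (rep t)) × walkTarget Q (rep t) (βSteps Q α (π t) (rep t)) ≡ iter (ξ Q α) (π t) (rep t)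
    walk = βSteps-walk (π t) (rep t)
    ∂b≡0 : ∀ v → ∂ (b t) v ≡ + 0
    ∂b≡0 v = trans (∂-inc (rep t) _ (proj₁ walk) v)
                   (trans (cong (λ w → δ Q (rep t) v - δ Q w v) (trans (proj₂ walk) (period t))) (+-inverseʳ (δ Q (rep t) v)))

  b-independent : ∀ t₀ (c : Fin ℓ → ℤ) → c t₀ ≡ + 0 → (∀ a → lincomb c b a ≡ + 0) → ∀ t → c t ≡ + 0
  b-independent t₀ c c[t₀]≡0 lincomb≡0 t = begin
    c t                                         ≡⟨ lincomb-orbitIndicator c t 0 ⟨
    lincomb c orbitIndicator (rep t)            ≡⟨ coboundary≡0⇒constant connected (lincomb c orbitIndicator) dW≡0 (rep t) (rep t₀) ⟩
    lincomb c orbitIndicator (rep t₀)           ≡⟨ lincomb-orbitIndicator c t₀ 0 ⟩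
    c t₀                                        ≡⟨ c[t₀]≡0 ⟩
    + 0                                         ∎
    where
    open ≡-Reasoning
    dW≡0 : ∀ i → coboundary (lincomb c orbitIndicator) i ≡ + 0
    dW≡0 i = trans (sym (applyGˇ-lincomb-b c i)) (trans (apply-cong (Gˇ Q) lincomb≡0 i) (apply-zero (Gˇ Q) i))

  -- ⟨inc(α w), Ǧx⟩ = ⟨inc(α w), Gx⟩ − ⟨x, Ǧ inc(α w)⟩ = 0 − (I(Q) x)_w = 0.
  ξ-invariant : ∀ x → InRad Q x → ∀ u → (∀ i → apply (Gˇ Q) x i ≡ coboundary u i) → ∀ w → u (ξ Q α w) ≡ u w
  ξ-invariant x x∈rad u Gˇx≡du w = sym (i-j≡0⇒i≡j (u w) (u (ξ Q α w)) (begin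
    u w - u (ξ Q α w)                                     ≡⟨ dot-inc-coboundary w (α w) (proj₁ (proj₁ (structural w))) u ⟨
    dot a (coboundary u)                                  ≡⟨ dot-congʳ a Gˇx≡du ⟨
    dot a (apply (Gˇ Q) x)                                ≡⟨ +-identityʳ _ ⟨
    dot a (apply (Gˇ Q) x) + + 0                          ≡⟨ cong (_+_ (dot a (apply (Gˇ Q) x))) dot-x-row≡0 ⟨
    dot a (apply (Gˇ Q) x) + dot x (apply (Gˇ Q) a)       ≡⟨ dot-symmetrize (Gˇ Q) (G Q) Gˇ+Gˇᵀ≡G a x ⟩
    dot a (apply (G Q) x)                                 ≡⟨ dot-zeroʳ a x∈rad ⟩
    + 0                                                   ∎))
    where
    open ≡-Reasoning
    a : Fin n → ℤ
    a = inc Q (α w)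
    dot-x-row≡0 : dot x (apply (Gˇ Q) a) ≡ + 0
    dot-x-row≡0 = trans (dot-congʳ x (applyGˇ-α w))
                        (trans (∑-cong (λ i → *-comm (x i) (Inc Q w i))) (InRad⇒∂≡0 x x∈rad w))

  ξ-invariant⇒lincomb-orbitIndicator : ∀ u → (∀ w → u (ξ Q α w) ≡ u w) → ∀ v → lincomb (u ∘ rep) orbitIndicator v ≡ u v
  ξ-invariant⇒lincomb-orbitIndicator u invariant v with cover v
  ... | t , k , refl = trans (lincomb-orbitIndicator (u ∘ rep) t k) (sym (constant-on-orbit k))
    where
    constant-on-orbit : ∀ k → u (iter (ξ Q α) k (rep t)) ≡ u (rep t)
    constant-on-orbit zero = refl
    constant-on-orbit (suc k) = trans (invariant _) (constant-on-orbit k)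

  potential⇒lincomb : ∀ x → InRad Q x → ∀ u → (∀ i → apply (Gˇ Q) x i ≡ coboundary u i) →
                      ∀ a → x a ≡ lincomb (u ∘ rep) b a
  potential⇒lincomb x x∈rad u Gˇx≡du a = i-j≡0⇒i≡j _ _ (Gˇ-kernel _ Gˇ[x-lincomb]≡0 a)
    where
    W≡u : ∀ v → lincomb (u ∘ rep) orbitIndicator v ≡ u v
    W≡u = ξ-invariant⇒lincomb-orbitIndicator u (ξ-invariant x x∈rad u Gˇx≡du)
    Gˇ[x-lincomb]≡0 : ∀ i → apply (Gˇ Q) (λ j → x j - lincomb (u ∘ rep) b j) i ≡ + 0
    Gˇ[x-lincomb]≡0 i = begin
      apply (Gˇ Q) (λ j → x j - lincomb (u ∘ rep) b j) i
        ≡⟨ apply-- (Gˇ Q) x (lincomb (u ∘ rep) b) i ⟩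
      apply (Gˇ Q) x i - apply (Gˇ Q) (lincomb (u ∘ rep) b) i
        ≡⟨ cong₂ _-_ (Gˇx≡du i) (applyGˇ-lincomb-b (u ∘ rep) i) ⟩
      coboundary u i - coboundary (lincomb (u ∘ rep) orbitIndicator) i
        ≡⟨ cong₂ (λ p q → coboundary u i - (p - q)) (W≡u (src i)) (W≡u (tgt i)) ⟩
      coboundary u i - coboundary u i
        ≡⟨ +-inverseʳ (coboundary u i) ⟩
      + 0 ∎
      where open ≡-Reasoning

  b-spanning : ∀ t₀ x → InRadRe Q x → ∃[ c ] c t₀ ≡ + 0 × (∀ a → x a ≡ lincomb c b a)
  b-spanning t₀ x (x∈rad , x⊥rad) =
    let u , u[rep-t₀]≡0 , Gˇx≡du = orthogonal⇒coboundary (apply (Gˇ Q) x) Gˇx⊥rad connected (rep t₀)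
    in u ∘ rep , u[rep-t₀]≡0 , potential⇒lincomb x x∈rad u Gˇx≡du
    where
    Gˇx⊥rad : ∀ y → InRad Q y → dot y (apply (Gˇ Q) x) ≡ + 0
    Gˇx⊥rad y y∈rad = trans (sym (dot-apply (Gˇ Q) y x)) (x⊥rad y y∈rad)

lemma2p4 : (Q : Quiver) → Loopless Q → Connected Q → 2 ≤ Quiver.m Q →
  (α : Fin (Quiver.m Q) → List (Step Q)) →
  (∀ v → Structural Q v (α v)) →
  (ℓ : ℕ) (rep : Fin ℓ → Fin (Quiver.m Q)) (π : Fin ℓ → ℕ) →
  (∀ t → 1 ≤ π t) →
  (∀ t → iter (ξ Q α) (π t) (rep t) ≡ rep t) →
  (∀ t k → 0 < k → k < π t → ¬ (iter (ξ Q α) k (rep t) ≡ rep t)) →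
  (∀ v → Σ (Fin ℓ) λ t → Σ ℕ λ k → iter (ξ Q α) k (rep t) ≡ v) →
  (∀ t t' k → iter (ξ Q α) k (rep t) ≡ rep t' → t ≡ t') →
  (∀ t t' → Data.Fin._≤_ t t' → π t' ≤ π t) →
  (t₀ : Fin ℓ) →
  let b = λ t → inc Q (βSteps Q α (π t) (rep t)) in
  (∀ t → ¬ (t ≡ t₀) → InRadRe Q (b t))
  × (∀ (c : Fin ℓ → ℤ) → c t₀ ≡ + 0 → (∀ a → lincomb c b a ≡ + 0) → ∀ t → c t ≡ + 0)
  × (∀ x → InRadRe Q x →
       Σ (Fin ℓ → ℤ) λ c → (c t₀ ≡ + 0) × (∀ a → x a ≡ lincomb c b a))
lemma2p4 Q loopless connected 2≤m α structural ℓ rep π 1≤π period minimal cover distinct _ t₀ =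
  (λ t _ → b∈radRe t) , b-independent t₀ , b-spanning t₀
  where open OrbitBasis Q loopless connected 2≤m α structural ℓ rep π 1≤π period minimal cover distinct
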